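{- For each Boolean circuit $C$ with a single output node that contains no gates other than $\neg$-gates, $\vee$-gates and $\wedge$-gates, there exists an $X\in\mathcal{IS}_{br}$ in which the basic instruction $\mathtt{out}.\mathtt{set{:}F}$ does not occur such that $X$ computes the Boolean function induced by $C$ and $|X|$ is linear in the size of $C$ (bounded by a linear function of the size of $C$ with constants independent of $C$).
   Context: Let $\mathbb B=\{\mathsf T,\mathsf F\}$. There are Boolean registers named $\mathtt{in}{:}i$ ($i\ge1$), $\mathtt{aux}{:}i$ ($i\ge1$) and $\mathtt{out}$, processing methods $\mathtt{set{:}T}$ (content becomes $\mathsf T$, reply $\mathsf T$), $\mathtt{set{:}F}$ (content becomes $\mathsf F$, reply $\mathsf F$), $\mathtt{get}$ (no change, reply is the content). Basic instructions are $f.m$ ($f$ register name, $m$ method). Primitive instructions: for each basic instruction $a$, the plain instruction $a$, positive test $+a$, negative test $-a$; forward jumps $\#l$ ($l\in\mathbb N$); termination $!$. An instruction sequence is a finite non-empty sequence $X=u_1;\dots;u_k$ of primitive instructions, $|X|=k$. Execution starts at $u_1$: $a$ executes $a$ and proceeds with the next instruction; $+a$ executes $a$ and proceeds with the next instruction if the reply is $\mathsf T$, otherwise skips the next instruction and proceeds with the one after; $-a$ likewise with reply roles reversed; $\#l$ proceeds with the $l$-th next instruction ($\#0$ causes inaction); $!$ terminates; if there is no instruction to proceed with, inaction occurs. $\mathcal{IS}_{br}$ is the set of instruction sequences whose basic instructions are all of the forms $\mathtt{in}{:}i.\mathtt{get}$, $\mathtt{aux}{:}i.\mathtt{get}$,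 $\mathtt{aux}{:}i.\mathtt{set{:}}b$, $\mathtt{out}.\mathtt{set{:}}b$ ($b\in\mathbb B$). $X$ computes $f:\mathbb B^n\to\mathbb B$ if for all $b_1,\dots,b_n$, executing $X$ with $\mathtt{in}{:}i$ initially $b_i$ ($i\le n$) and all auxiliary registers and $\mathtt{out}$ initially $\mathsf F$, execution never executes an instruction on $\mathtt{in}{:}i$ with $i>n$, ends by executing $!$, and leaves $f(b_1,\dots,b_n)$ in $\mathtt{out}$. For a Boolean circuit $C$ with $n$ input nodes and a single output node, the Boolean function induced by $C$ is $f:\mathbb B^n\to\mathbb B$ with $f(b_1,\dots,b_n)$ the output of $C$ on input $(b_1,\dots,b_n)$. -}

module Defs where

open import Data.Bool using (Bool; true; false; if_then_else_; not; _∨_; _∧_)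
open import Data.Nat using (ℕ; zero; suc; _<_; _≤_; _+_; _*_; _≟_; _<?_)
open import Data.Fin using (Fin; fromℕ<)
open import Data.Vec using (Vec; lookup; _∷ʳ_)
open import Data.List using (List; []; _∷_; length)
open import Data.List.NonEmpty using (List⁺; toList)
import Data.List.NonEmpty as L⁺
open import Data.List.Relation.Unary.All using (All)
open import Data.Product using (Σ; _×_; _,_)
open import Data.Unit using (⊤)
open import Data.Empty using (⊥)
open import Relation.Nullary using (¬_; yes; no)
open import Relation.Binary.PropositionalEquality using (_≡_)

-- Booleans: 𝔹 = Bool, with T = true and F = false.

-- Register names.  CONVENTION: `inR i` denotes in:(i+1) and `auxR i`
-- denotes aux:(i+1), so that indices start at 1 as in the paper.
data Reg : Set where
  inR  : ℕ → Reg
  auxR : ℕ → Reg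
  outR : Reg

data Method : Set where
  set : Bool → Method     -- set b is set:T (b = true) or set:F (b = false)
  get : Method

record BasicInstr : Set where
  constructor _∙_
  field
    reg    : Reg
    method : Method

data PrimInstr : Set where
  plain : BasicInstr → PrimInstr
  ptest : BasicInstr → PrimInstr
  ntest : BasicInstr → PrimInstr
  jump  : ℕ → PrimInstr
  halt  : PrimInstr

InstrSeq : Set
InstrSeq = List⁺ PrimInstr

∣_∣ : InstrSeq → ℕ
∣ X ∣ = L⁺.length X

AllowedBasic : BasicInstr → Set
AllowedBasic (inR i ∙ get)      = ⊤
AllowedBasic (inR i ∙ set b)    = ⊥
AllowedBasic (auxR i ∙ get)     = ⊤
AllowedBasic (auxR i ∙ set b)   = ⊤
AllowedBasic (outR ∙ set b)     = ⊤
AllowedBasic (outR ∙ get)       = ⊥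

BasicsSatisfy : (BasicInstr → Set) → PrimInstr → Set
BasicsSatisfy P (plain a) = P a
BasicsSatisfy P (ptest a) = P a
BasicsSatisfy P (ntest a) = P a
BasicsSatisfy P (jump l)  = ⊤
BasicsSatisfy P halt      = ⊤

InISbr : InstrSeq → Set
InISbr X = All (BasicsSatisfy AllowedBasic) (toList X)

NoOutSetF : InstrSeq → Set
NoOutSetF X = All (BasicsSatisfy (λ a → ¬ (a ≡ (outR ∙ set false)))) (toList X)

record State : Set where
  constructor st
  field
    inp : ℕ → Bool
    aux : ℕ → Bool
    out : Bool

data Outcome : Set where
  terminated : Bool → Outcome
  inaction   : Outcome
  badInput   : Outcome          -- executed an instruction on in:i with i > n

update : (ℕ → Bool) → ℕ → Bool → ℕ → Bool
update f i b j with i ≟ j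
... | yes _ = b
... | no  _ = f j

-- perform method m on a register with content c: (new content , reply)
perform : Method → Bool → Bool × Bool
perform (set b) c = b , b
perform get     c = c , c

data StepResult : Set where
  ok  : State → Bool → StepResult
  bad : StepResult

-- execute a basic instruction with n input registers in:1..in:n
execBasic : ℕ → BasicInstr → State → StepResult
execBasic n (inR i ∙ m) (st inp ax o) with i <? n
... | no  _ = bad
... | yes _ with perform m (inp i)
...   | c , r = ok (st (update inp i c) ax o) r
execBasic n (auxR i ∙ m) (st inp ax o) with perform m (ax i)
... | c , r = ok (st inp (update ax i c) o) r
execBasic n (outR ∙ m) (st inp ax o) with perform m o
... | c , r = ok (st inp ax c) r

-- run k s xs : execution proceeds with the k-th instruction (0-based) of xs.
-- Since all jumps go forward, this is structural on xs.
run : ℕ → State → ℕ → List PrimInstr → Outcome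

run n s (suc k) []       = inaction
run n s (suc k) (_ ∷ xs) = run n s k xs
run n s zero    []       = inaction
run n s zero (halt ∷ xs)          = terminated (State.out s)
run n s zero (jump zero ∷ xs)     = inaction
run n s zero (jump (suc l) ∷ xs)  = run n s l xs
run n s zero (plain a ∷ xs) with execBasic n a s
... | bad    = badInput
... | ok s' r = run n s' zero xs
run n s zero (ptest a ∷ xs) with execBasic n a s
... | bad    = badInput
... | ok s' true  = run n s' zero xs
... | ok s' false = run n s' 1 xs
run n s zero (ntest a ∷ xs) with execBasic n a s
... | bad    = badInput
... | ok s' true  = run n s' 1 xs
... | ok s' false = run n s' zero xs


initState : ∀ {n} → Vec Bool n → State
initState {n} v = st inp (λ _ → false) false
  where
  inp : ℕ → Bool
  inp i with i <? n
  ... | yes p = lookup v (fromℕ< p)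
  ... | no  _ = false

execute : ∀ {n} → InstrSeq → Vec Bool n → Outcome
execute {n} X v = run n (initState v) zero (toList X)

-- X computes f : 𝔹ⁿ → 𝔹: execution never touches in:i with i > n, ends by
-- executing !, and leaves f(b₁,…,bₙ) in out.
Computes : ∀ {n} → InstrSeq → (Vec Bool n → Bool) → Set
Computes {n} X f = ∀ (v : Vec Bool n) → execute X v ≡ terminated (f v)

data Gate (k : ℕ) : Set where
  ¬g    : Fin k → Gate k
  _∨g_  : Fin k → Fin k → Gate k
  _∧g_  : Fin k → Fin k → Gate k

-- Nodes n k : an acyclic circuit (topologically ordered) with n input
-- nodes and k nodes in total (the first n nodes are the input nodes).
data Nodes (n : ℕ) : ℕ → Set where
  inputs : Nodes n n
  _▷_    : ∀ {k} → Nodes n k → Gate k → Nodes n (suc k)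

record Circuit (n : ℕ) : Set where
  field
    numNodes : ℕ
    nodes    : Nodes n numNodes
    output   : Fin numNodes

size : ∀ {n} → Circuit n → ℕ
size C = Circuit.numNodes C

evalGate : ∀ {k} → Gate k → Vec Bool k → Bool
evalGate (¬g i)   vs = not (lookup vs i)
evalGate (i ∨g j) vs = lookup vs i ∨ lookup vs j
evalGate (i ∧g j) vs = lookup vs i ∧ lookup vs j

evalNodes : ∀ {n k} → Nodes n k → Vec Bool n → Vec Bool k
evalNodes inputs   v = v
evalNodes (ns ▷ g) v = let vs = evalNodes ns v in vs ∷ʳ evalGate g vs

induced : ∀ {n} → Circuit n → Vec Bool n → Bool
induced C v = lookup (evalNodes (Circuit.nodes C) v) (Circuit.output C)

-- The circuit is compiled gate by gate into a straight-line program that keeps the value of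
-- node j in aux:(j+1).  The inputs are first copied into the auxiliary registers; a gate
-- whose node is k then costs at most four instructions that test the registers of its
-- operands and conditionally execute aux:(k+1).set:T.  This suffices because aux:(k+1) still
-- holds its initial F, so "set to T if the gate is T, else do nothing" stores the value of
-- the gate.  Finally out is set to T iff the register of the output node holds T, which needs
-- no out.set:F because out starts with F.
module Submission where

open import Defs
open import Data.Bool using (Bool; true; false; not; _∨_; _∧_)
open import Data.Fin using (Fin; toℕ; fromℕ<)
open import Data.Fin.Properties using (toℕ-fromℕ<)
open import Data.List using (List; []; _∷_; _++_; length)
open import Data.List.NonEmpty using (List⁺; _∷_; _++⁺_; toList)
open import Data.List.Properties using (++-assoc; length-++)
open import Data.List.Relation.Unary.All as All using (All; []; _∷_)
import Data.List.Relation.Unary.All.Properties as Allₚ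
open import Data.Nat using (ℕ; zero; suc; _≤_; _<_; _+_; _*_; _≟_; _<?_; s≤s; z≤n)
open import Data.Nat.Properties
open import Data.Product using (Σ; _×_; _,_)
open import Data.Unit using (tt)
open import Data.Vec using (Vec; []; _∷_; lookup; _∷ʳ_; initLast)
open import Function using (_∘_)
open import Relation.Binary.PropositionalEquality
open import Relation.Nullary using (¬_; yes; no; contradiction)

private variable
  n k i j : ℕ
  inp inp′ ax ax′ : ℕ → Bool
  o b c : Bool
  s s′ : State
  xs ys : List PrimInstr

update-cong : ∀ {f g : ℕ → Bool} i b → f ≗ g → update f i b ≗ update g i b
update-cong i b f≗g j with i ≟ j
... | yes _ = refl
... | no  _ = f≗g j

update-id : ∀ (f : ℕ → Bool) i → f i ≡ b → update f i b ≗ f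
update-id f i fi≡b j with i ≟ j
... | yes refl = sym fi≡b
... | no  _    = refl

infix 4 _≈_ _≈ʳ_

data _≈_ : State → State → Set where
  st≈ : inp ≗ inp′ → ax ≗ ax′ → st inp ax o ≈ st inp′ ax′ o

data _≈ʳ_ : StepResult → StepResult → Set where
  bad : bad ≈ʳ bad
  ok  : s ≈ s′ → ok s b ≈ʳ ok s′ b

execBasic-cong : ∀ n a → s ≈ s′ → execBasic n a s ≈ʳ execBasic n a s′
execBasic-cong n (inR i ∙ m) (st≈ p q) with i <? n
... | no _ = bad
execBasic-cong n (inR i ∙ get) (st≈ {inp′ = inp′} p q) | yes _
  rewrite p i = ok (st≈ (update-cong i (inp′ i) p) q)
execBasic-cong n (inR i ∙ set b) (st≈ p q) | yes _ = ok (st≈ (update-cong i b p) q)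
execBasic-cong n (auxR i ∙ get) (st≈ {ax′ = ax′} p q)
  rewrite q i = ok (st≈ p (update-cong i (ax′ i) q))
execBasic-cong n (auxR i ∙ set b) (st≈ p q) = ok (st≈ p (update-cong i b q))
execBasic-cong n (outR ∙ get)     (st≈ p q) = ok (st≈ p q)
execBasic-cong n (outR ∙ set b)   (st≈ p q) = ok (st≈ p q)

run-cong : s ≈ s′ → ∀ l xs → run n s l xs ≡ run n s′ l xs
run-cong s≈s′ (suc l) []       = refl
run-cong s≈s′ (suc l) (_ ∷ xs) = run-cong s≈s′ l xs
run-cong s≈s′ zero [] = refl
run-cong s≈s′ zero (halt ∷ _) with s≈s′
... | st≈ _ _ = refl
run-cong s≈s′ zero (jump zero ∷ _)    = refl
run-cong s≈s′ zero (jump (suc l) ∷ xs) = run-cong s≈s′ l xs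
run-cong {s} {s′} {n} s≈s′ zero (plain a ∷ xs)
  with execBasic n a s | execBasic n a s′ | execBasic-cong n a s≈s′
... | _ | _ | bad = refl
... | _ | _ | ok r≈r′ = run-cong r≈r′ zero xs
run-cong {s} {s′} {n} s≈s′ zero (ptest a ∷ xs)
  with execBasic n a s | execBasic n a s′ | execBasic-cong n a s≈s′
... | _ | _ | bad = refl
... | _ | _ | ok {b = true}  r≈r′ = run-cong r≈r′ zero xs
... | _ | _ | ok {b = false} r≈r′ = run-cong r≈r′ 1 xs
run-cong {s} {s′} {n} s≈s′ zero (ntest a ∷ xs)
  with execBasic n a s | execBasic n a s′ | execBasic-cong n a s≈s′
... | _ | _ | bad = refl
... | _ | _ | ok {b = true}  r≈r′ = run-cong r≈r′ 1 xs
... | _ | _ | ok {b = false} r≈r′ = run-cong r≈r′ zero xs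

testOffset : Bool → ℕ
testOffset true  = 0
testOffset false = 1

ptest-readOnly : ∀ a → execBasic n a s ≡ ok s′ b → s′ ≈ s →
  run n s 0 (ptest a ∷ xs) ≡ run n s (testOffset b) xs
ptest-readOnly {b = true}  {xs = xs} a e s′≈s rewrite e = run-cong s′≈s 0 xs
ptest-readOnly {b = false} {xs = xs} a e s′≈s rewrite e = run-cong s′≈s 1 xs

ntest-readOnly : ∀ a → execBasic n a s ≡ ok s′ b → s′ ≈ s →
  run n s 0 (ntest a ∷ xs) ≡ run n s (testOffset (not b)) xs
ntest-readOnly {b = true}  {xs = xs} a e s′≈s rewrite e = run-cong s′≈s 1 xs
ntest-readOnly {b = false} {xs = xs} a e s′≈s rewrite e = run-cong s′≈s 0 xs

execBasic-in-get : i < n →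
  execBasic n (inR i ∙ get) (st inp ax o) ≡ ok (st (update inp i (inp i)) ax o) (inp i)
execBasic-in-get {i} {n} i<n with i <? n
... | yes _  = refl
... | no i≮n = contradiction i<n i≮n

getAux : ℕ → BasicInstr
getAux i = auxR i ∙ get

setAuxT : ℕ → PrimInstr
setAuxT k = plain (auxR k ∙ set true)

_‼_ : Vec Bool k → ℕ → Bool
[]       ‼ _     = false
(x ∷ _)  ‼ zero  = x
(_ ∷ xs) ‼ suc j = xs ‼ j

‼-lookup : (xs : Vec Bool k) (j : Fin k) → xs ‼ toℕ j ≡ lookup xs j
‼-lookup (x ∷ xs) Fin.zero    = refl
‼-lookup (x ∷ xs) (Fin.suc j) = ‼-lookup xs j

‼-length : (xs : Vec Bool k) → xs ‼ k ≡ false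
‼-length []       = refl
‼-length (_ ∷ xs) = ‼-length xs

‼-∷ʳ-last : (xs : Vec Bool k) (x : Bool) → (xs ∷ʳ x) ‼ k ≡ x
‼-∷ʳ-last []       x = refl
‼-∷ʳ-last (_ ∷ xs) x = ‼-∷ʳ-last xs x

‼-∷ʳ-other : (xs : Vec Bool k) (x : Bool) → j ≢ k → (xs ∷ʳ x) ‼ j ≡ xs ‼ j
‼-∷ʳ-other {j = zero}  []       x j≢0 = contradiction refl j≢0
‼-∷ʳ-other {j = suc j} []       x _   = refl
‼-∷ʳ-other {j = zero}  (_ ∷ xs) x _   = refl
‼-∷ʳ-other {j = suc j} (_ ∷ xs) x j≢k = ‼-∷ʳ-other xs x (j≢k ∘ cong suc)

‼-∷ʳ : (xs : Vec Bool k) (x : Bool) → update (xs ‼_) k x ≗ (xs ∷ʳ x) ‼_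
‼-∷ʳ {k} xs x j with k ≟ j
... | yes refl = sym (‼-∷ʳ-last xs x)
... | no  k≢j  = sym (‼-∷ʳ-other xs x (k≢j ∘ sym))

loadInputs : ℕ → List PrimInstr
loadInputs zero    = []
loadInputs (suc i) = loadInputs i ++ ptest (inR i ∙ get) ∷ setAuxT i ∷ []

gateCode : Gate k → List PrimInstr
gateCode {k} (¬g i)   = ntest (getAux (toℕ i)) ∷ setAuxT k ∷ []
gateCode {k} (i ∨g j) = ptest (getAux (toℕ i)) ∷ jump 2 ∷ ptest (getAux (toℕ j)) ∷ setAuxT k ∷ []
gateCode {k} (i ∧g j) = ntest (getAux (toℕ i)) ∷ jump 3 ∷ ptest (getAux (toℕ j)) ∷ setAuxT k ∷ []

nodesCode : Nodes n k → List PrimInstr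
nodesCode inputs   = []
nodesCode (ns ▷ g) = nodesCode ns ++ gateCode g

outputCode : ℕ → List⁺ PrimInstr
outputCode k = ptest (getAux k) ∷ plain (outR ∙ set true) ∷ halt ∷ []

module Execution (n : ℕ) (inp : ℕ → Bool) (o : Bool) where

  exec : (ℕ → Bool) → ℕ → List PrimInstr → Outcome
  exec ax = run n (st inp ax o)

  +in-get : ∀ ax → i < n → inp i ≡ b →
    exec ax 0 (ptest (inR i ∙ get) ∷ xs) ≡ exec ax (testOffset b) xs
  +in-get {i} ax i<n refl =
    ptest-readOnly (inR i ∙ get) (execBasic-in-get i<n) (st≈ (update-id inp i refl) (λ _ → refl))

  +aux-get : ∀ ax → ax i ≡ b → exec ax 0 (ptest (getAux i) ∷ xs) ≡ exec ax (testOffset b) xs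
  +aux-get {i} ax refl = ptest-readOnly (getAux i) refl (st≈ (λ _ → refl) (update-id ax i refl))

  -aux-get : ∀ ax → ax i ≡ b → exec ax 0 (ntest (getAux i) ∷ xs) ≡ exec ax (testOffset (not b)) xs
  -aux-get {i} ax refl = ntest-readOnly (getAux i) refl (st≈ (λ _ → refl) (update-id ax i refl))

  exec-update-false : ∀ ax → ax k ≡ false → ∀ l ys → exec ax l ys ≡ exec (update ax k false) l ys
  exec-update-false {k} ax axk≡F = run-cong (st≈ (λ _ → refl) (λ j → sym (update-id ax k axk≡F j)))

  setAuxT-if : ∀ ax → ax k ≡ false → ∀ b ys →
    exec ax (testOffset b) (setAuxT k ∷ ys) ≡ exec (update ax k b) 0 ys
  setAuxT-if ax axk≡F true  ys = refl
  setAuxT-if ax axk≡F false ys = exec-update-false ax axk≡F 0 ys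

  not-correct : ∀ ax → ax i ≡ b → ax k ≡ false →
    exec ax 0 (ntest (getAux i) ∷ setAuxT k ∷ ys) ≡ exec (update ax k (not b)) 0 ys
  not-correct {b = b} {ys = ys} ax axi axk = trans (-aux-get ax axi) (setAuxT-if ax axk (not b) ys)

  or-correct : ∀ ax → ax i ≡ b → ax j ≡ c → ax k ≡ false →
    exec ax 0 (ptest (getAux i) ∷ jump 2 ∷ ptest (getAux j) ∷ setAuxT k ∷ ys) ≡ exec (update ax k (b ∨ c)) 0 ys
  or-correct {b = true}  ax axi _   _   = +aux-get ax axi
  or-correct {b = false} {c = c} {ys = ys} ax axi axj axk =
    trans (+aux-get ax axi) (trans (+aux-get ax axj) (setAuxT-if ax axk c ys))

  and-correct : ∀ ax → ax i ≡ b → ax j ≡ c → ax k ≡ false →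
    exec ax 0 (ntest (getAux i) ∷ jump 3 ∷ ptest (getAux j) ∷ setAuxT k ∷ ys) ≡ exec (update ax k (b ∧ c)) 0 ys
  and-correct {b = false} {ys = ys} ax axi _ axk = trans (-aux-get ax axi) (exec-update-false ax axk 0 ys)
  and-correct {b = true} {c = c} {ys = ys} ax axi axj axk =
    trans (-aux-get ax axi) (trans (+aux-get ax axj) (setAuxT-if ax axk c ys))

  gateCode-correct : (g : Gate k) (vs : Vec Bool k) →
    exec (vs ‼_) 0 (gateCode g ++ ys) ≡ exec (update (vs ‼_) k (evalGate g vs)) 0 ys
  gateCode-correct (¬g i)   vs = not-correct (vs ‼_) (‼-lookup vs i) (‼-length vs)
  gateCode-correct (i ∨g j) vs = or-correct (vs ‼_) (‼-lookup vs i) (‼-lookup vs j) (‼-length vs)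
  gateCode-correct (i ∧g j) vs = and-correct (vs ‼_) (‼-lookup vs i) (‼-lookup vs j) (‼-length vs)

  nodesCode-correct : (ns : Nodes n k) (v : Vec Bool n) → ∀ ax → ax ≗ v ‼_ →
    exec ax 0 (nodesCode ns ++ ys) ≡ exec (evalNodes ns v ‼_) 0 ys
  nodesCode-correct {ys = ys} inputs v ax ax≗v = run-cong (st≈ (λ _ → refl) ax≗v) 0 ys
  nodesCode-correct {ys = ys} (_▷_ {k} ns g) v ax ax≗v = begin
    exec ax 0 ((nodesCode ns ++ gateCode g) ++ ys)
      ≡⟨ cong (exec ax 0) (++-assoc (nodesCode ns) (gateCode g) ys) ⟩
    exec ax 0 (nodesCode ns ++ gateCode g ++ ys)
      ≡⟨ nodesCode-correct ns v ax ax≗v ⟩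
    exec (vs ‼_) 0 (gateCode g ++ ys)
      ≡⟨ gateCode-correct g vs ⟩
    exec (update (vs ‼_) k (evalGate g vs)) 0 ys
      ≡⟨ run-cong (st≈ (λ _ → refl) (‼-∷ʳ vs (evalGate g vs))) 0 ys ⟩
    exec ((vs ∷ʳ evalGate g vs) ‼_) 0 ys ∎
    where
    open ≡-Reasoning
    vs = evalNodes ns v

  loadInputs-correct : i ≤ n → (w : Vec Bool i) → (∀ {j} → j < i → inp j ≡ w ‼ j) →
    exec (λ _ → false) 0 (loadInputs i ++ ys) ≡ exec (w ‼_) 0 ys
  loadInputs-correct {zero} _ [] _ = refl
  loadInputs-correct {suc i} {ys} i<n w inp≡w with initLast w
  ... | ws , y , refl = begin
    exec (λ _ → false) 0 ((loadInputs i ++ block) ++ ys)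
      ≡⟨ cong (exec (λ _ → false) 0) (++-assoc (loadInputs i) block ys) ⟩
    exec (λ _ → false) 0 (loadInputs i ++ block ++ ys)
      ≡⟨ loadInputs-correct (<⇒≤ i<n) ws inp≡ws ⟩
    exec (ws ‼_) 0 (block ++ ys)
      ≡⟨ +in-get (ws ‼_) i<n (trans (inp≡w ≤-refl) (‼-∷ʳ-last ws y)) ⟩
    exec (ws ‼_) (testOffset y) (setAuxT i ∷ ys)
      ≡⟨ setAuxT-if (ws ‼_) (‼-length ws) y ys ⟩
    exec (update (ws ‼_) i y) 0 ys
      ≡⟨ run-cong (st≈ (λ _ → refl) (‼-∷ʳ ws y)) 0 ys ⟩
    exec ((ws ∷ʳ y) ‼_) 0 ys ∎
    where
    open ≡-Reasoning
    block = ptest (inR i ∙ get) ∷ setAuxT i ∷ []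
    inp≡ws : ∀ {j} → j < i → inp j ≡ ws ‼ j
    inp≡ws j<i = trans (inp≡w (m<n⇒m<1+n j<i)) (‼-∷ʳ-other ws y (<⇒≢ j<i))

outputCode-correct : ∀ ax → ax k ≡ b →
  Execution.exec n inp false ax 0 (toList (outputCode k)) ≡ terminated b
outputCode-correct {b = true}  {n} {inp} ax axk = Execution.+aux-get n inp false ax axk
outputCode-correct {b = false} {n} {inp} ax axk = Execution.+aux-get n inp false ax axk

toList-++⁺ : ∀ {A : Set} (xs : List A) ys → toList (xs ++⁺ ys) ≡ xs ++ toList ys
toList-++⁺ []       ys = refl
toList-++⁺ (x ∷ xs) ys with xs ++⁺ ys | toList-++⁺ xs ys
... | _ ∷ _ | eq = cong (x ∷_) eq

compile : Circuit n → InstrSeq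
compile {n} C = (loadInputs n ++ nodesCode nodes) ++⁺ outputCode (toℕ output)
  where open Circuit C

initState-inp : (v : Vec Bool n) → j < n → State.inp (initState v) j ≡ v ‼ j
initState-inp {n} {j} v j<n with j <? n
... | yes p  = sym (trans (cong (v ‼_) (sym (toℕ-fromℕ< p))) (‼-lookup v (fromℕ< p)))
... | no j≮n = contradiction j<n j≮n

compile-correct : (C : Circuit n) → Computes (compile C) (induced C)
compile-correct {n} C v = begin
  exec (λ _ → false) 0 (toList (compile C))
    ≡⟨ cong (exec (λ _ → false) 0) (toList-++⁺ (loadInputs n ++ nodesCode nodes) (outputCode (toℕ output))) ⟩
  exec (λ _ → false) 0 ((loadInputs n ++ nodesCode nodes) ++ out)
    ≡⟨ cong (exec (λ _ → false) 0) (++-assoc (loadInputs n) (nodesCode nodes) out) ⟩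
  exec (λ _ → false) 0 (loadInputs n ++ nodesCode nodes ++ out)
    ≡⟨ loadInputs-correct ≤-refl v (initState-inp v) ⟩
  exec (v ‼_) 0 (nodesCode nodes ++ out)
    ≡⟨ nodesCode-correct nodes v (v ‼_) (λ _ → refl) ⟩
  exec (evalNodes nodes v ‼_) 0 out
    ≡⟨ outputCode-correct (evalNodes nodes v ‼_) (‼-lookup (evalNodes nodes v) output) ⟩
  terminated (induced C v) ∎
  where
  open ≡-Reasoning
  open Circuit C
  open Execution n (State.inp (initState v)) false
  out = toList (outputCode (toℕ output))

data Emitted : BasicInstr → Set where
  in-get   : ∀ i → Emitted (inR i ∙ get)
  aux-get  : ∀ i → Emitted (getAux i)
  aux-setT : ∀ i → Emitted (auxR i ∙ set true)
  out-setT : Emitted (outR ∙ set true)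

Emits : List PrimInstr → Set
Emits = All (BasicsSatisfy Emitted)

BasicsSatisfy-map : ∀ {P Q : BasicInstr → Set} → (∀ {a} → P a → Q a) →
  ∀ u → BasicsSatisfy P u → BasicsSatisfy Q u
BasicsSatisfy-map P⊆Q (plain a) = P⊆Q
BasicsSatisfy-map P⊆Q (ptest a) = P⊆Q
BasicsSatisfy-map P⊆Q (ntest a) = P⊆Q
BasicsSatisfy-map P⊆Q (jump l)  = λ _ → tt
BasicsSatisfy-map P⊆Q halt      = λ _ → tt

emitted-allowed : ∀ {a} → Emitted a → AllowedBasic a
emitted-allowed (in-get _)   = tt
emitted-allowed (aux-get _)  = tt
emitted-allowed (aux-setT _) = tt
emitted-allowed out-setT     = tt

emitted-≢-outSetF : ∀ {a} → Emitted a → ¬ a ≡ outR ∙ set false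
emitted-≢-outSetF (in-get _)   ()
emitted-≢-outSetF (aux-get _)  ()
emitted-≢-outSetF (aux-setT _) ()
emitted-≢-outSetF out-setT     ()

loadInputs-emits : ∀ i → Emits (loadInputs i)
loadInputs-emits zero    = []
loadInputs-emits (suc i) = Allₚ.++⁺ (loadInputs-emits i) (in-get i ∷ aux-setT i ∷ [])

gateCode-emits : (g : Gate k) → Emits (gateCode g)
gateCode-emits (¬g i)   = aux-get _ ∷ aux-setT _ ∷ []
gateCode-emits (i ∨g j) = aux-get _ ∷ tt ∷ aux-get _ ∷ aux-setT _ ∷ []
gateCode-emits (i ∧g j) = aux-get _ ∷ tt ∷ aux-get _ ∷ aux-setT _ ∷ []

nodesCode-emits : (ns : Nodes n k) → Emits (nodesCode ns)
nodesCode-emits inputs   = []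
nodesCode-emits (ns ▷ g) = Allₚ.++⁺ (nodesCode-emits ns) (gateCode-emits g)

compile-emits : (C : Circuit n) → Emits (toList (compile C))
compile-emits {n} C =
  subst Emits (sym (toList-++⁺ (loadInputs n ++ nodesCode nodes) (outputCode (toℕ output))))
    (Allₚ.++⁺ (Allₚ.++⁺ (loadInputs-emits n) (nodesCode-emits nodes)) (aux-get _ ∷ out-setT ∷ tt ∷ []))
  where open Circuit C

compile-inISbr : (C : Circuit n) → InISbr (compile C)
compile-inISbr C = All.map (λ {u} → BasicsSatisfy-map emitted-allowed u) (compile-emits C)

compile-noOutSetF : (C : Circuit n) → NoOutSetF (compile C)
compile-noOutSetF C = All.map (λ {u} → BasicsSatisfy-map emitted-≢-outSetF u) (compile-emits C)

∣∣≡length-toList : (X : InstrSeq) → ∣ X ∣ ≡ length (toList X)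
∣∣≡length-toList (_ ∷ _) = refl

loadInputs-length : ∀ i → length (loadInputs i) ≡ 2 * i
loadInputs-length zero    = refl
loadInputs-length (suc i) = begin
  length (loadInputs i ++ _)  ≡⟨ length-++ (loadInputs i) ⟩
  length (loadInputs i) + 2   ≡⟨ cong (_+ 2) (loadInputs-length i) ⟩
  2 * i + 2                   ≡⟨ +-comm (2 * i) 2 ⟩
  2 + 2 * i                   ≡⟨ *-suc 2 i ⟨
  2 * suc i                   ∎
  where open ≡-Reasoning

gateCode-length : (g : Gate k) → length (gateCode g) ≤ 4
gateCode-length (¬g i)   = s≤s (s≤s z≤n)
gateCode-length (i ∨g j) = ≤-refl
gateCode-length (i ∧g j) = ≤-refl

nodesCode-length : (ns : Nodes n k) → 4 * n + length (nodesCode ns) ≤ 4 * k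
nodesCode-length {n} inputs = ≤-reflexive (+-identityʳ (4 * n))
nodesCode-length {n} (_▷_ {k} ns g) = begin
  4 * n + length (nodesCode ns ++ gateCode g)
    ≡⟨ cong (4 * n +_) (length-++ (nodesCode ns)) ⟩
  4 * n + (length (nodesCode ns) + length (gateCode g))
    ≡⟨ +-assoc (4 * n) _ _ ⟨
  4 * n + length (nodesCode ns) + length (gateCode g)
    ≤⟨ +-mono-≤ (nodesCode-length ns) (gateCode-length g) ⟩
  4 * k + 4
    ≡⟨ +-comm (4 * k) 4 ⟩
  4 + 4 * k
    ≡⟨ *-suc 4 k ⟨
  4 * suc k ∎
  where open ≤-Reasoning

compile-length : (C : Circuit n) → ∣ compile C ∣ ≤ 4 * size C + 3
compile-length {n} C = begin
  ∣ compile C ∣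
    ≡⟨ ∣∣≡length-toList (compile C) ⟩
  length (toList (compile C))
    ≡⟨ cong length (toList-++⁺ (loadInputs n ++ nodesCode nodes) (outputCode (toℕ output))) ⟩
  length ((loadInputs n ++ nodesCode nodes) ++ _)
    ≡⟨ length-++ (loadInputs n ++ nodesCode nodes) ⟩
  length (loadInputs n ++ nodesCode nodes) + 3
    ≡⟨ cong (_+ 3) (length-++ (loadInputs n)) ⟩
  length (loadInputs n) + length (nodesCode nodes) + 3
    ≡⟨ cong (λ l → l + length (nodesCode nodes) + 3) (loadInputs-length n) ⟩
  2 * n + length (nodesCode nodes) + 3
    ≤⟨ +-monoˡ-≤ 3 (+-monoˡ-≤ (length (nodesCode nodes)) (*-monoˡ-≤ n (m≤m+n 2 2))) ⟩
  4 * n + length (nodesCode nodes) + 3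
    ≤⟨ +-monoˡ-≤ 3 (nodesCode-length nodes) ⟩
  4 * size C + 3 ∎
  where
  open ≤-Reasoning
  open Circuit C

proposition5 : Σ ℕ λ c → Σ ℕ λ d → ∀ {n} (C : Circuit n) →
    Σ InstrSeq λ X → InISbr X × NoOutSetF X × Computes X (induced C) × ∣ X ∣ ≤ c * size C + d
proposition5 = 4 , 3 , λ C →
  compile C ,
  compile-inISbr C ,
  compile-noOutSetF C ,
  compile-correct C ,
  compile-length C
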